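{- Let $N\in\mathbb{N}$ and $a\in\mathbb{Z}$ be coprime, and let $m:=\operatorname{ord}_N(a)$. Then $\operatorname{ord}_p(a)=m$ for all primes $p$ dividing $N$ if and only if $\gcd(N,a^{m/r}-1)=1$ for all primes $r$ dividing $m$.
   Context: $\operatorname{ord}_n(a)$ denotes the multiplicative order of $a$ modulo $n$. -}

module Defs where

open import Data.Nat using (ℕ; _≤_; NonZero)
open import Data.Integer using (ℤ; +_; _-_; _^_; 1ℤ)
open import Data.Integer.Divisibility using (_∣_)
open import Data.Product using (_×_)

IsOrd : ℕ → ℤ → ℕ → Set
IsOrd n a m =
  NonZero m × ((+ n) ∣ (a ^ m - 1ℤ)) ×
  (∀ k → NonZero k → (+ n) ∣ (a ^ k - 1ℤ) → m ≤ k)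

{-# OPTIONS --safe #-}
-- The exponents k with n ∣ a^k - 1 are closed under gcd, so m = ord_n(a) exactly when
-- n ∣ a^m - 1 but n ∤ a^(m/r) - 1 for every prime r ∣ m. For the primes p ∣ N the first
-- condition is inherited from N, and the second holding for all such p says precisely
-- that no prime divides both N and a^(m/r) - 1, i.e. gcd(N, a^(m/r) - 1) = 1.
module Submission where

open import Defs
open import Data.Nat using (ℕ; NonZero; _/_)
open import Data.Nat.Divisibility using (_∣_)
open import Data.Nat.Primality using (Prime; prime⇒nonZero)
open import Data.Integer using (ℤ; +_; _-_; _^_; 1ℤ)
open import Data.Integer.GCD using (gcd)
open import Data.Integer.Coprimality using (Coprime)
open import Function.Bundles using (_⇔_)
open import Relation.Binary.PropositionalEquality using (_≡_)

open import Data.Nat as ℕ using (zero; suc; _≤_; _<_; z≤n; s≤s)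
import Data.Nat.Properties as ℕ
import Data.Nat.Divisibility as ℕ
import Data.Nat.GCD as ℕ
import Data.Nat.DivMod as ℕ
open import Data.Nat.Primality using (¬prime[1]; prime⇒nonTrivial)
open import Data.Nat.Primality.Factorisation using (factorise)
import Data.Integer as ℤ
import Data.Integer.Properties as ℤ
import Data.Integer.Divisibility as ℤ
import Data.Integer.Divisibility.Signed as ℤˢ
open import Data.Integer.Tactic.RingSolver using (solve-∀)
open import Data.List using ([]; _∷_)
open import Data.Nat.ListAction using (product)
open import Data.List.Relation.Unary.All using (_∷_)
open import Data.Product using (∃; _×_; _,_)
open import Data.Sum using (inj₁)
open import Relation.Nullary using (¬_; yes; no; contradiction)
open import Relation.Binary.PropositionalEquality using (refl; sym; trans; cong; subst; _≢_; ≢-sym)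
open import Function.Bundles using (mk⇔)

∃-prime-∣ : ∀ {n} → 1 < n → ∃ λ p → Prime p × p ∣ n
∃-prime-∣ {n@(suc (suc _))} (s≤s (s≤s z≤n)) with factorise n
... | record { factors = [] ; isFactorisation = () }
... | record { factors = p ∷ ps ; isFactorisation = n≡Πps ; factorsPrime = prime[p] ∷ _ } =
  p , prime[p] , subst (p ∣_) (sym n≡Πps) (ℕ.m∣m*n (product ps))

-- r is any prime factor of m / d.
proper-divisor⇒∃-prime-r*d∣ : ∀ {d m} .{{_ : NonZero m}} → d ∣ m → d ≢ m →
                              ∃ λ r → Prime r × r ℕ.* d ∣ m
proper-divisor⇒∃-prime-r*d∣ {d} {m} d∣m d≢m
  with r , prime[r] , r∣c ← ∃-prime-∣ (ℕ.quotient>1 d∣m (ℕ.≤∧≢⇒< (ℕ.∣⇒≤ d∣m) d≢m)) =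
  r , prime[r] , subst (r ℕ.* d ∣_) (sym (ℕ.m∣n⇒n≡quotient*m d∣m)) (ℕ.*-monoˡ-∣ d r∣c)

gcd≡1⇒common-divisor≡1 : ∀ N (x : ℤ) {p} → gcd (+ N) x ≡ 1ℤ → p ∣ N → + p ℤ.∣ x → p ≡ 1
gcd≡1⇒common-divisor≡1 N x gcd≡1 p∣N p∣x =
  ℕ.∣1⇒≡1 (subst (_ ∣_) (ℤ.+-injective gcd≡1) (ℕ.gcd-greatest p∣N p∣x))

gcd≢1⇒∃-common-prime : ∀ N (x : ℤ) .{{_ : NonZero N}} → gcd (+ N) x ≢ 1ℤ →
                       ∃ λ p → Prime p × p ∣ N × + p ℤ.∣ x
gcd≢1⇒∃-common-prime N x gcd≢1 with ∃-prime-∣ g>1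
  where
  g>1 : 1 < ℕ.gcd N ℤ.∣ x ∣
  g>1 = ℕ.≤∧≢⇒< (ℕ.n≢0⇒n>0 (ℕ.gcd[m,n]≢0 N _ (inj₁ (ℕ.≢-nonZero⁻¹ N))))
                 (≢-sym λ g≡1 → gcd≢1 (cong +_ g≡1))
... | p , prime[p] , p∣g =
  p , prime[p] , ℕ.∣-trans p∣g (ℕ.gcd[m,n]∣m N _) , ℕ.∣-trans p∣g (ℕ.gcd[m,n]∣n N _)

module Periods (d a : ℤ) where

  Period : ℕ → Set
  Period k = d ℤ.∣ a ^ k - 1ℤ

  a^[x+y]-1≡a^y*[a^x-1]+[a^y-1] : ∀ x y →
    a ^ (x ℕ.+ y) - 1ℤ ≡ a ^ y ℤ.* (a ^ x - 1ℤ) ℤ.+ (a ^ y - 1ℤ)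
  a^[x+y]-1≡a^y*[a^x-1]+[a^y-1] x y rewrite ℤ.^-distribˡ-+-* a x y = identity (a ^ x) (a ^ y)
    where
    identity : ∀ u v → u ℤ.* v - 1ℤ ≡ v ℤ.* (u - 1ℤ) ℤ.+ (v - 1ℤ)
    identity = solve-∀

  period-0 : Period 0
  period-0 = ℕ._∣0 _

  period-+ : ∀ x y → Period x → Period y → Period (x ℕ.+ y)
  period-+ x y px py rewrite a^[x+y]-1≡a^y*[a^x-1]+[a^y-1] x y = ℤˢ.∣⇒∣ᵤ {d}
    (ℤˢ.∣m∣n⇒∣m+n (ℤˢ.∣n⇒∣m*n (a ^ y) (ℤˢ.∣ᵤ⇒∣ {d} px)) (ℤˢ.∣ᵤ⇒∣ {d} py))

  period-+-cancelˡ : ∀ x y → Period (x ℕ.+ y) → Period x → Period y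
  period-+-cancelˡ x y pxy px rewrite a^[x+y]-1≡a^y*[a^x-1]+[a^y-1] x y = ℤˢ.∣⇒∣ᵤ {d}
    (ℤˢ.∣m+n∣m⇒∣n (ℤˢ.∣ᵤ⇒∣ {d} pxy) (ℤˢ.∣n⇒∣m*n (a ^ y) (ℤˢ.∣ᵤ⇒∣ {d} px)))

  period-* : ∀ t x → Period x → Period (t ℕ.* x)
  period-* zero    x px = period-0
  period-* (suc t) x px = period-+ x (t ℕ.* x) px (period-* t x px)

  period-∣ : ∀ {x y} → x ∣ y → Period x → Period y
  period-∣ {x} (ℕ.divides t refl) = period-* t x

  -- Bézout: gcd x y + v y = u x (or symmetrically), and v y, u x are periods.
  period-gcd : ∀ x y → Period x → Period y → Period (ℕ.gcd x y)
  period-gcd x y px py with ℕ.Bézout.identity (ℕ.gcd-GCD x y)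
  ... | ℕ.Bézout.+- u v g+v*y≡u*x = period-+-cancelˡ (v ℕ.* y) (ℕ.gcd x y)
          (subst Period (trans (sym g+v*y≡u*x) (ℕ.+-comm _ (v ℕ.* y))) (period-* u x px))
          (period-* v y py)
  ... | ℕ.Bézout.-+ u v g+u*x≡v*y = period-+-cancelˡ (u ℕ.* x) (ℕ.gcd x y)
          (subst Period (trans (sym g+u*x≡v*y) (ℕ.+-comm _ (u ℕ.* x))) (period-* v y py))
          (period-* u x px)

open Periods

isOrd⇒¬period[m/r] : ∀ {n m} {a : ℤ} → IsOrd n a m → ∀ r → (pr : Prime r) → r ∣ m →
                     ¬ Period (+ n) a (_/_ m r {{prime⇒nonZero pr}})
isOrd⇒¬period[m/r] {m = m} (nz[m] , _ , m-least) r pr r∣m period[m/r] =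
  ℕ.<⇒≱ (ℕ.m/n<m m r (ℕ.nonTrivial⇒n>1 r)) (m-least (m / r) nz[m/r] period[m/r])
  where
  instance
    _ = nz[m]
    _ = prime⇒nonZero pr
    _ = prime⇒nonTrivial pr
  nz[m/r] : NonZero (m / r)
  nz[m/r] = ℕ.>-nonZero (ℕ.m≥n⇒m/n>0 (ℕ.∣⇒≤ r∣m))

-- For a period k, gcd m k is a period dividing m; were it proper, it would divide some m / r.
period∧¬period[m/r]⇒isOrd : ∀ {n m} {a : ℤ} → NonZero m → Period (+ n) a m →
  (∀ r → (pr : Prime r) → r ∣ m → ¬ Period (+ n) a (_/_ m r {{prime⇒nonZero pr}})) →
  IsOrd n a m
period∧¬period[m/r]⇒isOrd {n} {m} {a} nz[m] period[m] ¬period[m/r] = nz[m] , period[m] , m-least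
  where
  instance _ = nz[m]
  m-least : ∀ k → NonZero k → Period (+ n) a k → m ≤ k
  m-least k nz[k] period[k] with ℕ.gcd m k ℕ.≟ m
  ... | yes g≡m = ℕ.∣⇒≤ {{nz[k]}} (subst (_∣ k) g≡m (ℕ.gcd[m,n]∣n m k))
  ... | no g≢m with proper-divisor⇒∃-prime-r*d∣ (ℕ.gcd[m,n]∣m m k) g≢m
  ...   | r , pr , r*g∣m = contradiction
          (period-∣ (+ n) a (ℕ.m*n∣o⇒n∣o/m r _ {{prime⇒nonZero pr}} r*g∣m)
                    (period-gcd (+ n) a m k period[m] period[k]))
          (¬period[m/r] r pr (ℕ.m*n∣⇒m∣ r _ r*g∣m))

lemma2p3 : (N : ℕ) → NonZero N → (a : ℤ) → Coprime (+ N) a → (m : ℕ) → IsOrd N a m →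
    ((∀ p → Prime p → p ∣ N → IsOrd p a m)
      ⇔ (∀ r → (pr : Prime r) → r ∣ m →
           gcd (+ N) (a ^ (_/_ m r {{prime⇒nonZero pr}}) - 1ℤ) ≡ 1ℤ))
lemma2p3 N nz[N] a _ m (nz[m] , period[m] , _) = mk⇔ forward backward
  where
  instance _ = nz[N]
  a^[m/r]-1 : ∀ r → Prime r → ℤ
  a^[m/r]-1 r pr = a ^ (_/_ m r {{prime⇒nonZero pr}}) - 1ℤ
  forward : (∀ p → Prime p → p ∣ N → IsOrd p a m) →
            ∀ r → (pr : Prime r) → r ∣ m → gcd (+ N) (a^[m/r]-1 r pr) ≡ 1ℤ
  forward isOrd[p] r pr r∣m with gcd (+ N) (a^[m/r]-1 r pr) ℤ.≟ 1ℤ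
  ... | yes gcd≡1 = gcd≡1
  ... | no gcd≢1 with gcd≢1⇒∃-common-prime N (a^[m/r]-1 r pr) gcd≢1
  ...   | p , pp , p∣N , period[m/r] =
          contradiction period[m/r] (isOrd⇒¬period[m/r] (isOrd[p] p pp p∣N) r pr r∣m)
  backward : (∀ r → (pr : Prime r) → r ∣ m → gcd (+ N) (a^[m/r]-1 r pr) ≡ 1ℤ) →
             ∀ p → Prime p → p ∣ N → IsOrd p a m
  backward gcd≡1 p pp p∣N = period∧¬period[m/r]⇒isOrd nz[m] (ℕ.∣-trans p∣N period[m])
    λ r pr r∣m period[m/r] → ¬prime[1] (subst Prime
      (gcd≡1⇒common-divisor≡1 N (a^[m/r]-1 r pr) (gcd≡1 r pr r∣m) p∣N period[m/r]) pp)
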